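{- Let $n\geq 1$, let $U_{6n}=\langle a,b\mid a^{2n}=b^3=1,\ a^{ -1}ba=b^{ -1}\rangle$, and let $\Gamma=\Gamma(U_{6n})$ be its non-commuting graph. Then the minimum size of a vertex cover of $\Gamma$ is $\tau(\Gamma)=3n$.
   Context: The group $U_{6n}$ has order $6n$ and center $Z(U_{6n})=\langle a^2\rangle$. For a finite group $G$, the non-commuting graph $\Gamma(G)$ has vertex set $G\setminus Z(G)$, and two distinct vertices $x,y$ are adjacent iff $xy\neq yx$. A vertex cover is a set $S$ of vertices such that every edge has at least one endpoint in $S$. -}

module Defs where

open import Data.Nat using (ℕ; suc; _*_; _+_; _∸_; _%_; _≡ᵇ_; NonZero)
open import Data.Nat.DivMod using (_mod_)
open import Data.Fin using (Fin; toℕ)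
open import Data.Product using (_×_; _,_)
open import Data.Bool using (if_then_else_)
open import Data.List using (List; length)
open import Data.List.Membership.Propositional using (_∈_)
open import Data.List.Relation.Unary.All using (All)
open import Data.List.Relation.Unary.Unique.Propositional using (Unique)
open import Data.Sum using (_⊎_)
open import Relation.Binary.PropositionalEquality using (_≡_)
open import Relation.Nullary using (¬_)

-- Concrete model of U_{6n} = ⟨ a , b | a^{2n} = b^3 = 1 , a⁻¹ b a = b⁻¹ ⟩
-- for n = suc m.  The pair (i , j) stands for the normal form a^i b^j,
-- with i ∈ ℤ/2n and j ∈ ℤ/3.  From b^j a^k = a^k b^{(-1)^k j} we get
--   (a^i b^j)(a^k b^l) = a^{i+k} b^{(-1)^k j + l}.
U : ℕ → Set
U m = Fin (2 * suc m) × Fin 3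

twist : ℕ → Fin 3 → Fin 3
twist k j = if (k % 2) ≡ᵇ 0 then j else ((3 ∸ toℕ j) mod 3)

mul : (m : ℕ) → U m → U m → U m
mul m (i , j) (k , l) =
  ((toℕ i + toℕ k) mod (2 * suc m)) , ((toℕ (twist (toℕ k) j) + toℕ l) mod 3)

Central : (m : ℕ) → U m → Set
Central m z = ∀ g → mul m z g ≡ mul m g z

Adjacent : (m : ℕ) → U m → U m → Set
Adjacent m x y = ¬ (mul m x y ≡ mul m y x)

IsVertexCover : (m : ℕ) → List (U m) → Set
IsVertexCover m S =
  Unique S × All (λ x → ¬ Central m x) S ×
  (∀ x y → ¬ Central m x → ¬ Central m y → Adjacent m x y → x ∈ S ⊎ y ∈ S)

-- Elements a^(2k) b^j lie in the abelian subgroup ⟨a², b⟩, so every edge has an endpoint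
-- a^i b^c with i odd, and the 3n such elements form a cover.  Such an element commutes
-- with a^k b^l only for l = 0 (k even) or l = c (k odd), so it has 4n neighbours; a cover
-- missing one of them contains all its neighbours, hence has at least 4n ≥ 3n elements.
module Submission where

open import Defs
open import Data.Bool as Bool using (Bool; true; false; if_then_else_)
open import Data.Bool.Properties using (¬-not)
open import Data.Empty using (⊥-elim)
open import Data.Fin as Fin using (Fin; zero; toℕ; fromℕ<; punchIn; remQuot; combine)
open import Data.Fin.Properties
  using (toℕ-fromℕ<; toℕ-injective; toℕ<n; punchIn-injective; punchInᵢ≢i;
         remQuot-combine; combine-remQuot; injective⇒≤; all?; ¬∀⟶∃¬)
open import Data.List using (List; length; tabulate; lookup)
open import Data.List.Properties using (length-tabulate)
open import Data.List.Membership.Propositional using (_∈_; _∉_)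
open import Data.List.Membership.Propositional.Properties using (∈-tabulate⁺)
import Data.List.Membership.DecPropositional as DecMembership
open import Data.List.Relation.Unary.Any as Any using ()
open import Data.List.Relation.Unary.Any.Properties using (lookup-index)
import Data.List.Relation.Unary.All.Properties as All
import Data.List.Relation.Unary.Unique.Propositional.Properties as Unique
open import Data.Nat using (ℕ; suc; _*_; _+_; _∸_; _%_; _/_; _≡ᵇ_; _≤_; _<_; s≤s)
open import Data.Nat.DivMod using (_mod_; m≡m%n+[m/n]*n; [m+kn]%n≡m%n; m%n<n; m<n*o⇒m/o<n)
open import Data.Nat.Properties
  using (+-comm; *-comm; *-assoc; *-monoˡ-≤; *-cancelʳ-≡; suc-injective; n≤1+n; ≤-trans)
open import Data.Product using (_×_; Σ; ∃; _,_; proj₁; proj₂; uncurry)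
open import Data.Product.Properties using (≡-dec)
open import Data.Sum as Sum using (_⊎_; inj₁; inj₂)
open import Function using (_∘_)
open import Function.Definitions using (Injective)
open import Relation.Binary.Definitions using (DecidableEquality)
open import Relation.Binary.PropositionalEquality
open import Relation.Nullary using (¬_; yes; no)
open import Relation.Nullary.Decidable using (from-yes; _→-dec_)

isEven : ℕ → Bool
isEven n = n % 2 ≡ᵇ 0

isEven-1+n*2 : ∀ n → isEven (1 + n * 2) ≡ false
isEven-1+n*2 n = cong (_≡ᵇ 0) ([m+kn]%n≡m%n 1 n 2)

odd⇒≡1+[n/2]*2 : ∀ n → isEven n ≡ false → n ≡ 1 + n / 2 * 2
odd⇒≡1+[n/2]*2 n odd with n % 2 | m≡m%n+[m/n]*n n 2 | m%n<n n 2
... | 1 | n≡ | _ = n≡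
... | suc (suc _) | _ | s≤s (s≤s ())

module _ (m : ℕ) where

  1+t*2<2*[1+m] : (t : Fin (suc m)) → 1 + toℕ t * 2 < 2 * suc m
  1+t*2<2*[1+m] t = subst (1 + toℕ t * 2 <_) (*-comm (suc m) 2) (*-monoˡ-≤ 2 (toℕ<n t))

  oddExp : Fin (suc m) → Fin (2 * suc m)
  oddExp t = fromℕ< (1+t*2<2*[1+m] t)

  toℕ-oddExp : ∀ t → toℕ (oddExp t) ≡ 1 + toℕ t * 2
  toℕ-oddExp t = toℕ-fromℕ< (1+t*2<2*[1+m] t)

  isEven-oddExp : ∀ t → isEven (toℕ (oddExp t)) ≡ false
  isEven-oddExp t = trans (cong isEven (toℕ-oddExp t)) (isEven-1+n*2 (toℕ t))

  oddExp-injective : Injective _≡_ _≡_ oddExp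
  oddExp-injective {t} {u} eq = toℕ-injective (*-cancelʳ-≡ (toℕ t) (toℕ u) 2
    (suc-injective (trans (sym (toℕ-oddExp t)) (trans (cong toℕ eq) (toℕ-oddExp u)))))

  odd⇒oddExp : ∀ i → isEven (toℕ i) ≡ false → ∃ λ t → i ≡ oddExp t
  odd⇒oddExp i odd = fromℕ< half< , toℕ-injective (begin
      toℕ i                       ≡⟨ odd⇒≡1+[n/2]*2 (toℕ i) odd ⟩
      1 + toℕ i / 2 * 2           ≡⟨ cong (λ h → 1 + h * 2) (toℕ-fromℕ< half<) ⟨
      1 + toℕ (fromℕ< half<) * 2  ≡⟨ toℕ-oddExp (fromℕ< half<) ⟨
      toℕ (oddExp (fromℕ< half<)) ∎)
    where
    open ≡-Reasoning
    half< : toℕ i / 2 < suc m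
    half< = m<n*o⇒m/o<n (subst (toℕ i <_) (*-comm 2 (suc m)) (toℕ<n i))

-- bExp (isEven (toℕ k)) j l is the b-exponent of (a^i b^j)(a^k b^l)
bExp : Bool → Fin 3 → Fin 3 → Fin 3
bExp even j l = (toℕ (if even then j else (3 ∸ toℕ j) mod 3) + toℕ l) mod 3

commutingExp : Bool → Fin 3 → Fin 3
commutingExp even c = if even then zero else c

bExp-true-comm : ∀ j l → bExp true j l ≡ bExp true l j
bExp-true-comm j l = cong (_mod 3) (+-comm (toℕ j) (toℕ l))

bExp-comm-false⇒ : ∀ even c l → bExp even c l ≡ bExp false l c → l ≡ commutingExp even c
bExp-comm-false⇒ true  = from-yes (all? λ c → all? λ l →
  bExp true c l Fin.≟ bExp false l c →-dec l Fin.≟ zero)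
bExp-comm-false⇒ false = from-yes (all? λ c → all? λ l →
  bExp false c l Fin.≟ bExp false l c →-dec l Fin.≟ c)

module _ {m : ℕ} where

  commute⇒bExp : ∀ {i j k l} → mul m (i , j) (k , l) ≡ mul m (k , l) (i , j) →
                 bExp (isEven (toℕ k)) j l ≡ bExp (isEven (toℕ i)) l j
  commute⇒bExp = cong proj₂

  bExp⇒commute : ∀ {i j k l} → bExp (isEven (toℕ k)) j l ≡ bExp (isEven (toℕ i)) l j →
                 mul m (i , j) (k , l) ≡ mul m (k , l) (i , j)
  bExp⇒commute {i} {k = k} = cong₂ _,_ (cong (_mod (2 * suc m)) (+-comm (toℕ i) (toℕ k)))

  even-commute : ∀ {i j k l} → isEven (toℕ i) ≡ true → isEven (toℕ k) ≡ true →
                 mul m (i , j) (k , l) ≡ mul m (k , l) (i , j)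
  even-commute {i} {j} {k} {l} i-even k-even = bExp⇒commute {i} {j} {k} {l}
    (subst₂ (λ e e′ → bExp e j l ≡ bExp e′ l j) (sym k-even) (sym i-even)
      (bExp-true-comm j l))

  odd-commute⇒ : ∀ {i c k l} → isEven (toℕ i) ≡ false →
                 mul m (i , c) (k , l) ≡ mul m (k , l) (i , c) →
                 l ≡ commutingExp (isEven (toℕ k)) c
  odd-commute⇒ {i} {c} {k} {l} i-odd comm = bExp-comm-false⇒ (isEven (toℕ k)) c l
    (subst (λ e → bExp (isEven (toℕ k)) c l ≡ bExp e l c) i-odd
      (commute⇒bExp {i} {c} {k} {l} comm))

  adjacent⇒¬centralˡ : ∀ {x y} → Adjacent m x y → ¬ Central m x
  adjacent⇒¬centralˡ {y = y} adj central = adj (central y)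

  adjacent⇒¬centralʳ : ∀ {x y} → Adjacent m x y → ¬ Central m y
  adjacent⇒¬centralʳ {x} adj central = adj (sym (central x))

injective⇒≤length : ∀ {a} {A : Set a} {n} {xs : List A} (f : Fin n → A) →
                    Injective _≡_ _≡_ f → (∀ i → f i ∈ xs) → n ≤ length xs
injective⇒≤length {xs = xs} f f-injective f∈xs = injective⇒≤ index-injective
  where
  open ≡-Reasoning
  index-injective : Injective _≡_ _≡_ (Any.index ∘ f∈xs)
  index-injective {i} {j} eq = f-injective (begin
    f i                            ≡⟨ lookup-index (f∈xs i) ⟩
    lookup xs (Any.index (f∈xs i)) ≡⟨ cong (lookup xs) eq ⟩
    lookup xs (Any.index (f∈xs j)) ≡⟨ lookup-index (f∈xs j) ⟨
    f j                            ∎)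

remQuot-injective : ∀ {n} k → Injective _≡_ _≡_ (remQuot {n} k)
remQuot-injective {n} k {i} {j} eq = begin
  i                                 ≡⟨ combine-remQuot {n} k i ⟨
  uncurry combine (remQuot {n} k i) ≡⟨ cong (uncurry combine) eq ⟩
  uncurry combine (remQuot {n} k j) ≡⟨ combine-remQuot {n} k j ⟩
  j                                 ∎
  where open ≡-Reasoning

vertexCover-∉⇒adjacent-∈ : ∀ {m S x y} →
                           IsVertexCover m S → x ∉ S → Adjacent m x y → y ∈ S
vertexCover-∉⇒adjacent-∈ {m} {x = x} {y} (_ , _ , covers) x∉S adj
  with covers x y (adjacent⇒¬centralˡ {m} adj) (adjacent⇒¬centralʳ {m} adj) adj
... | inj₁ x∈S = ⊥-elim (x∉S x∈S)
... | inj₂ y∈S = y∈S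

module _ (m : ℕ) where

  adjacent⇒odd⊎odd : ∀ {i j k l} → Adjacent m (i , j) (k , l) →
                     isEven (toℕ i) ≡ false ⊎ isEven (toℕ k) ≡ false
  adjacent⇒odd⊎odd {i} {j} {k} {l} adj
    with isEven (toℕ i) Bool.≟ false | isEven (toℕ k) Bool.≟ false
  ... | yes i-odd | _         = inj₁ i-odd
  ... | no _      | yes k-odd = inj₂ k-odd
  ... | no i-even | no k-even =
    ⊥-elim (adj (even-commute {m} {i} {j} {k} {l} (¬-not i-even) (¬-not k-even)))

  -- punchIn r enumerates the two exponents in Fin 3 other than r
  neighbour : Fin 3 → Fin 2 × Fin (2 * suc m) → U m
  neighbour c (s , k) = k , punchIn (commutingExp (isEven (toℕ k)) c) s

  neighbour-injective : ∀ c → Injective _≡_ _≡_ (neighbour c)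
  neighbour-injective c {s , k} {s′ , k′} eq with cong proj₁ eq
  ... | refl = cong (_, k) (punchIn-injective _ s s′ (cong proj₂ eq))

  odd-adjacent-neighbour : ∀ {i c} → isEven (toℕ i) ≡ false →
                           ∀ sk → Adjacent m (i , c) (neighbour c sk)
  odd-adjacent-neighbour {i} {c} i-odd (s , k) comm =
    punchInᵢ≢i _ s (odd-commute⇒ {m} {i} {c} {k} i-odd comm)

  odd⇒¬central : ∀ {i c} → isEven (toℕ i) ≡ false → ¬ Central m (i , c)
  odd⇒¬central {i} {c} i-odd =
    adjacent⇒¬centralˡ {m} (odd-adjacent-neighbour {i} {c} i-odd (zero , zero))

  _≟U_ : DecidableEquality (U m)
  _≟U_ = ≡-dec Fin._≟_ Fin._≟_

  open DecMembership _≟U_ using (_∈?_)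

  oddElement : Fin (3 * suc m) → U m
  oddElement q = oddExp m (proj₂ (remQuot {3} (suc m) q)) , proj₁ (remQuot {3} (suc m) q)

  oddElement-injective : Injective _≡_ _≡_ oddElement
  oddElement-injective eq = remQuot-injective {3} (suc m)
    (cong₂ _,_ (cong proj₂ eq) (oddExp-injective m (cong proj₁ eq)))

  oddElements : List (U m)
  oddElements = tabulate oddElement

  odd-∈-oddElements : ∀ {i c} → isEven (toℕ i) ≡ false → (i , c) ∈ oddElements
  odd-∈-oddElements {i} {c} i-odd with odd⇒oddExp m i i-odd
  ... | t , refl =
    subst (_∈ oddElements)
      (cong (λ (c′ , t′) → oddExp m t′ , c′) (remQuot-combine c t))
      (∈-tabulate⁺ {f = oddElement} (combine c t))

  oddElements-isVertexCover : IsVertexCover m oddElements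
  oddElements-isVertexCover =
      Unique.tabulate⁺ {f = oddElement} oddElement-injective
    , All.tabulate⁺ {f = oddElement}
        (λ q → odd⇒¬central (isEven-oddExp m (proj₂ (remQuot {3} (suc m) q))))
    , λ { (i , j) (k , l) _ _ adj →
          Sum.map (odd-∈-oddElements {i} {j}) (odd-∈-oddElements {k} {l})
            (adjacent⇒odd⊎odd {i} {j} {k} {l} adj) }

  odd∉vertexCover⇒4[1+m]≤length : ∀ {S} → IsVertexCover m S →
                                  ∀ {i c} → isEven (toℕ i) ≡ false → (i , c) ∉ S →
                                  4 * suc m ≤ length S
  odd∉vertexCover⇒4[1+m]≤length {S} cover {i} {c} i-odd x∉S =
    subst (_≤ length S) (sym (*-assoc 2 2 (suc m)))
      (injective⇒≤length neighbourAt neighbourAt-injective neighbourAt∈S)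
    where
    neighbourAt : Fin (2 * (2 * suc m)) → U m
    neighbourAt = neighbour c ∘ remQuot {2} (2 * suc m)
    neighbourAt-injective : Injective _≡_ _≡_ neighbourAt
    neighbourAt-injective eq = remQuot-injective {2} (2 * suc m) (neighbour-injective c eq)
    neighbourAt∈S : ∀ r → neighbourAt r ∈ S
    neighbourAt∈S r = vertexCover-∉⇒adjacent-∈ cover x∉S
      (odd-adjacent-neighbour {i} {c} i-odd (remQuot {2} (2 * suc m) r))

  vertexCover⇒3[1+m]≤length : ∀ S → IsVertexCover m S → 3 * suc m ≤ length S
  vertexCover⇒3[1+m]≤length S cover with all? (λ q → oddElement q ∈? S)
  ... | yes oddElements⊆S =
    injective⇒≤length {xs = S} oddElement oddElement-injective oddElements⊆S
  ... | no oddElements⊈S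
    with ¬∀⟶∃¬ (3 * suc m) (λ q → oddElement q ∈ S) (λ q → oddElement q ∈? S) oddElements⊈S
  ... | q , x∉S = ≤-trans (*-monoˡ-≤ (suc m) (n≤1+n 3))
    (odd∉vertexCover⇒4[1+m]≤length cover x-odd x∉S)
    where
    x-odd : isEven (toℕ (proj₁ (oddElement q))) ≡ false
    x-odd = isEven-oddExp m (proj₂ (remQuot {3} (suc m) q))

corollary2p8 : (m : ℕ) →
    (Σ (List (U m)) (λ S → IsVertexCover m S × length S ≡ 3 * suc m)) ×
    ((S : List (U m)) → IsVertexCover m S → 3 * suc m ≤ length S)
corollary2p8 m =
  (oddElements m , oddElements-isVertexCover m , length-tabulate (oddElement m)) ,
  vertexCover⇒3[1+m]≤length m
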